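{- (1) $pc(HP_3)=pc(HL_3)=2$. (2) $2\leq pc(HP_4)\leq 3$ and $pc(HL_4)=2$.
   Context: Let $\mathcal{P}$ denote the Petersen graph and $Q_k$ the $k$-dimensional hypercube ($Q_0=K_1$, $Q_1=K_2$). For $n\geq 3$, $HP_n=Q_{n-3}\Box\mathcal{P}$ (Cartesian product) and $HL_n=Q_{n-3}\circ\mathcal{P}$ (lexicographic product); in particular $HP_3=HL_3=\mathcal{P}$. The Cartesian product $G\Box H$ has vertex set $V(G)\times V(H)$, with $(g,h)\sim(g',h')$ iff ($g=g'$ and $hh'\in E(H)$) or ($h=h'$ and $gg'\in E(G)$); the lexicographic product $G\circ H$ has vertex set $V(G)\times V(H)$, with $(g,h)\sim(g',h')$ iff $gg'\in E(G)$, or ($g=g'$ and $hh'\in E(H)$). In an edge-colored graph (adjacent edges may receive the same color), a path is a proper path if no two adjacent edges of the path have the same color. The proper connection number $pc(G)$ of a connected graph $G$ is the minimum number of colors in an edge-coloring of $G$ such that every two distinct vertices are joined by a proper path. -}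

module Defs where

open import Data.Nat using (ℕ; _∸_; _≤_)
open import Data.Fin using (Fin; _<_)
open import Data.Bool using (Bool)
open import Data.Vec using (Vec; lookup)
open import Data.List using (List; _∷_; []; _++_; [_])
open import Data.List.Relation.Unary.Linked using (Linked)
open import Data.List.Relation.Unary.Unique.Propositional using (Unique)
open import Data.Product using (Σ; _×_; ∃-syntax; _,_; proj₁; proj₂)
open import Data.Sum using (_⊎_)
open import Data.Unit using (⊤)
open import Data.Empty using (⊥)
open import Relation.Binary.PropositionalEquality using (_≡_; _≢_; refl; sym)
open import Relation.Nullary using (¬_)

record Graph : Set₁ where
  field
    V     : Set
    _∼_   : V → V → Set
    irrefl : ∀ {u} → ¬ (u ∼ u)
    sym∼  : ∀ {u v} → u ∼ v → v ∼ u
open Graph public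

-- Petersen graph as Kneser graph K(5,2): vertices are 2-subsets {i,j}
-- (i < j) of Fin 5, adjacent iff disjoint.
PV : Set
PV = Σ (Fin 5 × Fin 5) (λ p → proj₁ p < proj₂ p)

P-adj : PV → PV → Set
P-adj ((a , b) , _) ((c , d) , _) = a ≢ c × a ≢ d × b ≢ c × b ≢ d

Petersen : Graph
Petersen = record
  { V = PV
  ; _∼_ = P-adj
  ; irrefl = λ { (a≢a , _) → a≢a refl }
  ; sym∼ = λ { (p , q , r , s) → (λ e → p (sym e))
                                , (λ e → r (sym e))
                                , (λ e → q (sym e))
                                , (λ e → s (sym e)) }
  }

Q-adj : (k : ℕ) → Vec Bool k → Vec Bool k → Set
Q-adj k x y = ∃[ i ] (lookup x i ≢ lookup y i × (∀ j → j ≢ i → lookup x j ≡ lookup y j))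

Q : ℕ → Graph
Q k = record
  { V = Vec Bool k
  ; _∼_ = Q-adj k
  ; irrefl = λ { (i , ne , _) → ne refl }
  ; sym∼ = λ { (i , ne , eq) → i , (λ e → ne (sym e))
                              , (λ j j≢i → sym (eq j j≢i)) }
  }

_□_ : Graph → Graph → Graph
G □ H = record
  { V = V G × V H
  ; _∼_ = adj
  ; irrefl = irr
  ; sym∼ = sy
  }
  where
  open import Data.Sum using (inj₁; inj₂)
  adj : V G × V H → V G × V H → Set
  adj (g , h) (g' , h') = (g ≡ g' × _∼_ H h h') ⊎ (h ≡ h' × _∼_ G g g')
  irr : ∀ {u} → ¬ adj u u
  irr (inj₁ (_ , a)) = irrefl H a
  irr (inj₂ (_ , a)) = irrefl G a
  sy : ∀ {u v} → adj u v → adj v u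
  sy (inj₁ (e , a)) = inj₁ (sym e , sym∼ H a)
  sy (inj₂ (e , a)) = inj₂ (sym e , sym∼ G a)

_⊙_ : Graph → Graph → Graph
G ⊙ H = record
  { V = V G × V H
  ; _∼_ = adj
  ; irrefl = irr
  ; sym∼ = sy
  }
  where
  open import Data.Sum using (inj₁; inj₂)
  adj : V G × V H → V G × V H → Set
  adj (g , h) (g' , h') = _∼_ G g g' ⊎ (g ≡ g' × _∼_ H h h')
  irr : ∀ {u} → ¬ adj u u
  irr (inj₁ a) = irrefl G a
  irr (inj₂ (_ , a)) = irrefl H a
  sy : ∀ {u v} → adj u v → adj v u
  sy (inj₁ a) = inj₁ (sym∼ G a)
  sy (inj₂ (e , a)) = inj₂ (sym e , sym∼ H a)

-- HP_n = Q_{n-3} □ P and HL_n = Q_{n-3} ∘ P  (intended for n ≥ 3)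
HP : ℕ → Graph
HP n = Q (n ∸ 3) □ Petersen

HL : ℕ → Graph
HL n = Q (n ∸ 3) ⊙ Petersen

-- An edge-coloring with (at most) k colors: a symmetric color assignment to
-- ordered vertex pairs; only its values on edges matter.
record EdgeColoring (G : Graph) (k : ℕ) : Set where
  field
    col     : V G → V G → Fin k
    col-sym : ∀ u v → col u v ≡ col v u
open EdgeColoring public

ProperCols : ∀ {G k} → EdgeColoring G k → List (V G) → Set
ProperCols c (a ∷ b ∷ d ∷ rest) = col c a b ≢ col c b d × ProperCols c (b ∷ d ∷ rest)
ProperCols c _ = ⊤

ProperPath : (G : Graph) {k : ℕ} → EdgeColoring G k → V G → V G → Set
ProperPath G c u v =
  Σ (List (V G)) λ mid →
    Linked (_∼_ G) (u ∷ mid ++ [ v ]) ×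
    Unique (u ∷ mid ++ [ v ]) ×
    ProperCols c (u ∷ mid ++ [ v ])

ProperConnected : (G : Graph) {k : ℕ} → EdgeColoring G k → Set
ProperConnected G c = ∀ u v → u ≢ v → ProperPath G c u v

IsPC : Graph → ℕ → Set
IsPC G k =
  Σ (EdgeColoring G k) (ProperConnected G) ×
  (∀ k' → Data.Nat._<_ k' k → (c : EdgeColoring G k') → ¬ ProperConnected G c)

-- Colour red exactly the five spokes of the Petersen graph, the edges between the outer
-- 5-cycle of pairs {i, i+1} and the inner pentagram of pairs {i, i+2} (mod 5), and pull
-- this colouring back along the projection of Q_k □ P and Q_k ∘ P onto P. For k ≤ 1
-- every two vertices are then joined by a proper path; an iterative-deepening search finds
-- one for each pair and a decision procedure certifies it. One colour never suffices,
-- since a path between two non-adjacent vertices has two consecutive edges.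
module Submission where

open import Defs
open import Data.Bool using (T?; Bool; true; false; T; not; _∧_; _∨_; _xor_; if_then_else_)
open import Data.Bool.Properties using (xor-comm; T-∨) renaming (_≟_ to _≟ᵇ_)
open import Data.Empty using (⊥-elim)
open import Data.Fin using (Fin; zero; toℕ)
open import Data.Fin.Patterns using (0F; 1F; 2F)
open import Data.Fin.Properties as Finₚ using (¬Fin0; <-irrelevant) renaming (_≟_ to _≟ᶠ_; _<?_ to _<ᶠ?_)
open import Data.List using (List; []; _∷_; _++_; [_]; foldr; length; upTo; allFin; cartesianProduct; cartesianProductWith)
open import Data.List.Membership.Propositional using (_∈_)
open import Data.List.Membership.Propositional.Properties using (∈-allFin; ∈-cartesianProduct⁺; ∈-cartesianProductWith⁺)
import Data.List.Membership.DecPropositional as DecMembership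
open import Data.List.Relation.Unary.All as All using (All)
open import Data.List.Relation.Unary.Any using (here; there)
open import Data.List.Relation.Unary.AllPairs using (allPairs?)
open import Data.List.Relation.Unary.Linked using (Linked; linked?; _∷_)
open import Data.List.Relation.Unary.Unique.Propositional using (Unique)
open import Data.Maybe using (Maybe; just; nothing; maybe′; _<∣>_) renaming (map to mapᵐ)
open import Data.Nat using (ℕ; zero; suc; _∸_; _≡ᵇ_; _<_; _≤_; z≤n; s≤s)
open import Data.Nat.Properties using (≤-refl; n≤1+n)
open import Data.Product using (Σ; _×_; _,_; proj₂)
open import Data.Product.Properties using (≡-dec)
open import Data.Sum using (inj₁; inj₂)
open import Data.Unit using (tt)
open import Data.Vec using (Vec; []; _∷_; lookup; replicate)
import Data.Vec.Properties as Vecₚ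
open import Function using (_∘_; Equivalence)
open import Relation.Binary.Definitions using (Decidable; DecidableEquality)
open import Relation.Binary.PropositionalEquality using (_≡_; _≢_; refl; cong)
open import Relation.Nullary using (¬_; Dec; yes; no; ¬?; Irrelevant)
open import Relation.Nullary.Decidable using (True; isYes; toWitness; _×-dec_; _⊎-dec_; _→-dec_)

private variable
  G H : Graph

NonComplete : Graph → Set
NonComplete G = Σ (V G) λ u → Σ (V G) λ v → u ≢ v × ¬ _∼_ G u v

Fin1-irrelevant : (i j : Fin 1) → i ≡ j
Fin1-irrelevant zero zero = refl

nonComplete⇒¬properConnected<2 : NonComplete G → ∀ k → k < 2 → (c : EdgeColoring G k) → ¬ ProperConnected G c
nonComplete⇒¬properConnected<2 (u , v , _ , _) zero _ c _ = ¬Fin0 (col c u v)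
nonComplete⇒¬properConnected<2 (u , v , u≢v , u≁v) (suc zero) _ c pc with pc u v u≢v
... | []        , u∼v ∷ _ , _              = u≁v u∼v
... | _ ∷ []    , _       , _ , differ , _ = differ (Fin1-irrelevant _ _)
... | _ ∷ _ ∷ _ , _       , _ , differ , _ = differ (Fin1-irrelevant _ _)
nonComplete⇒¬properConnected<2 _ (suc (suc _)) (s≤s (s≤s ()))

isPC-2 : NonComplete G → Σ (EdgeColoring G 2) (ProperConnected G) → IsPC G 2
isPC-2 nc properColoring = properColoring , nonComplete⇒¬properConnected<2 nc

cutColoring : (V G → Bool) → EdgeColoring G 2
cutColoring side = record
  { col     = λ u v → colour (side u xor side v)
  ; col-sym = λ u v → cong colour (xor-comm (side u) (side v))
  }
  where
  colour : Bool → Fin 2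
  colour b = if b then 1F else 0F

witnesses : {A : Set} {P : A → Set} → (∀ x → Dec (P x)) → List A → List (Σ A P)
witnesses P? [] = []
witnesses P? (x ∷ xs) with P? x
... | yes p = (x , p) ∷ witnesses P? xs
... | no _  = witnesses P? xs

∈-witnesses⁺ : {A : Set} {P : A → Set} (P? : ∀ x → Dec (P x)) → (∀ {x} → Irrelevant (P x)) →
               ∀ {x xs} (p : P x) → x ∈ xs → (x , p) ∈ witnesses P? xs
∈-witnesses⁺ P? irr {x} p (here refl) with P? x
... | yes q = here (cong (x ,_) (irr p q))
... | no ¬p = ⊥-elim (¬p p)
∈-witnesses⁺ P? irr {xs = y ∷ _} p (there x∈xs) with P? y
... | yes _ = there (∈-witnesses⁺ P? irr p x∈xs)
... | no _  = ∈-witnesses⁺ P? irr p x∈xs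

module ProperConnectivity (G : Graph) (_≟_ : DecidableEquality (V G)) (_∼?_ : Decidable (_∼_ G))
                          (vs : List (V G)) (vs-complete : ∀ u → u ∈ vs) where

  open DecMembership _≟_ using (_∈?_)

  module _ {k : ℕ} (c : EdgeColoring G k) where

    properCols? : ∀ xs → Dec (ProperCols c xs)
    properCols? (a ∷ b ∷ d ∷ rest) = ¬? (col c a b ≟ᶠ col c b d) ×-dec properCols? (b ∷ d ∷ rest)
    properCols? []                 = yes tt
    properCols? (_ ∷ [])           = yes tt
    properCols? (_ ∷ _ ∷ [])       = yes tt

    ProperPathVia : V G → V G → List (V G) → Set
    ProperPathVia u v mid =
      Linked (_∼_ G) (u ∷ mid ++ [ v ]) × Unique (u ∷ mid ++ [ v ]) × ProperCols c (u ∷ mid ++ [ v ])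

    properPathVia? : ∀ u v mid → Dec (ProperPathVia u v mid)
    properPathVia? u v mid = linked? _∼?_ _ ×-dec allPairs? (λ x y → ¬? (x ≟ y)) _ ×-dec properCols? _

    -- last is the colour of the edge entering x, nothing at the start of a path
    continues : Maybe (Fin k) → V G → V G → Bool
    continues last x y = isYes (x ∼? y) ∧ maybe′ (λ l → not (isYes (l ≟ᶠ col c x y))) true last

    search : (depth : ℕ) → (visited : List (V G)) → Maybe (Fin k) → V G → V G → Maybe (List (V G))
    search depth visited last x v with continues last x v
    ... | true = just []
    search zero        visited last x v | false = nothing
    search (suc depth) visited last x v | false = foldr (λ y r → through y <∣> r) nothing vs
      where
      through : V G → Maybe (List (V G))
      through y = if continues last x y ∧ not (isYes (y ∈? (v ∷ visited)))
                  then mapᵐ (y ∷_) (search depth (y ∷ visited) (just (col c x y)) y v)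
                  else nothing

    -- iterative deepening: plain depth-first search is much slower to evaluate here
    route : V G → V G → Maybe (List (V G))
    route u v = foldr (λ depth r → search depth [ u ] nothing u v <∣> r) nothing (upTo (length vs))

    certifies : V G → V G → Maybe (List (V G)) → Bool
    certifies u v = maybe′ (isYes ∘ properPathVia? u v) false

    certifies-sound : ∀ u v m → T (certifies u v m) → ProperPath G c u v
    certifies-sound u v (just mid) ok = mid , toWitness {a? = properPathVia? u v mid} ok

    joins : V G → V G → Bool
    joins u v = isYes (u ≟ v) ∨ certifies u v (route u v)

    joins-sound : ∀ u v → T (joins u v) → u ≢ v → ProperPath G c u v
    joins-sound u v j u≢v with Equivalence.to T-∨ j
    ... | inj₁ u≡v = ⊥-elim (u≢v (toWitness {a? = u ≟ v} u≡v))
    ... | inj₂ ok  = certifies-sound u v (route u v) ok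

    allJoined? : Dec (All (λ u → All (λ v → T (joins u v)) vs) vs)
    allJoined? = All.all? (λ u → All.all? (λ v → T? (joins u v)) vs) vs

    properConnected : True allJoined? → ProperConnected G c
    properConnected ok u v =
      joins-sound u v (All.lookup (All.lookup (toWitness ok) (vs-complete u)) (vs-complete v))

_≟ᴾ_ : DecidableEquality PV
_≟ᴾ_ = ≡-dec (≡-dec _≟ᶠ_ _≟ᶠ_) λ p q → yes (<-irrelevant p q)

P-adj? : Decidable P-adj
P-adj? ((a , b) , _) ((c , d) , _) = ¬? (a ≟ᶠ c) ×-dec ¬? (a ≟ᶠ d) ×-dec ¬? (b ≟ᶠ c) ×-dec ¬? (b ≟ᶠ d)

petersenVertices : List PV
petersenVertices = witnesses (λ (i , j) → i <ᶠ? j) (cartesianProduct (allFin 5) (allFin 5))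

petersenVertices-complete : ∀ u → u ∈ petersenVertices
petersenVertices-complete ((i , j) , i<j) =
  ∈-witnesses⁺ (λ (i , j) → i <ᶠ? j) <-irrelevant i<j (∈-cartesianProduct⁺ (∈-allFin i) (∈-allFin j))

Petersen-nonComplete : NonComplete Petersen
Petersen-nonComplete = ((0F , 1F) , s≤s z≤n) , ((0F , 2F) , s≤s z≤n) , (λ ()) , λ (0≢0 , _) → 0≢0 refl

onOuterCycle : PV → Bool
onOuterCycle ((i , j) , _) = (toℕ j ∸ toℕ i ≡ᵇ 1) ∨ (toℕ j ∸ toℕ i ≡ᵇ 4)

Q-adj? : ∀ k → Decidable (Q-adj k)
Q-adj? k x y = Finₚ.any? λ i →
  ¬? (lookup x i ≟ᵇ lookup y i) ×-dec Finₚ.all? λ j → ¬? (j ≟ᶠ i) →-dec (lookup x j ≟ᵇ lookup y j)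

bitVectors : ∀ k → List (Vec Bool k)
bitVectors zero    = [ [] ]
bitVectors (suc k) = cartesianProductWith _∷_ (false ∷ true ∷ []) (bitVectors k)

bitVectors-complete : ∀ {k} (x : Vec Bool k) → x ∈ bitVectors k
bitVectors-complete []      = here refl
bitVectors-complete (b ∷ x) = ∈-cartesianProductWith⁺ _∷_ (∈-bits b) (bitVectors-complete x)
  where
  ∈-bits : ∀ b → b ∈ false ∷ true ∷ []
  ∈-bits false = here refl
  ∈-bits true  = there (here refl)

□-adj? : DecidableEquality (V G) → DecidableEquality (V H) → Decidable (_∼_ G) → Decidable (_∼_ H) →
         Decidable (_∼_ (G □ H))
□-adj? _≟G_ _≟H_ _∼G?_ _∼H?_ (g , h) (g' , h') = (g ≟G g' ×-dec h ∼H? h') ⊎-dec (h ≟H h' ×-dec g ∼G? g')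

⊙-adj? : DecidableEquality (V G) → Decidable (_∼_ G) → Decidable (_∼_ H) → Decidable (_∼_ (G ⊙ H))
⊙-adj? _≟G_ _∼G?_ _∼H?_ (g , h) (g' , h') = g ∼G? g' ⊎-dec (g ≟G g' ×-dec h ∼H? h')

□-nonComplete : V G → NonComplete H → NonComplete (G □ H)
□-nonComplete g (h , h' , h≢h' , h≁h') = (g , h) , (g , h') , (λ e → h≢h' (cong proj₂ e)) , λ
  { (inj₁ (_ , h∼h')) → h≁h' h∼h'
  ; (inj₂ (h≡h' , _)) → h≢h' h≡h'
  }

⊙-nonComplete : V G → NonComplete H → NonComplete (G ⊙ H)
⊙-nonComplete {G} g (h , h' , h≢h' , h≁h') = (g , h) , (g , h') , (λ e → h≢h' (cong proj₂ e)) , λ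
  { (inj₁ g∼g)        → irrefl G g∼g
  ; (inj₂ (_ , h∼h')) → h≁h' h∼h'
  }

module HypercubePetersen (k : ℕ) where

  _≟ᴴ_ : DecidableEquality (Vec Bool k × PV)
  _≟ᴴ_ = ≡-dec (Vecₚ.≡-dec _≟ᵇ_) _≟ᴾ_

  vertices : List (Vec Bool k × PV)
  vertices = cartesianProduct (bitVectors k) petersenVertices

  vertices-complete : ∀ u → u ∈ vertices
  vertices-complete (x , p) = ∈-cartesianProduct⁺ (bitVectors-complete x) (petersenVertices-complete p)

  module □-Petersen = ProperConnectivity (Q k □ Petersen) _≟ᴴ_
    (□-adj? {Q k} {Petersen} (Vecₚ.≡-dec _≟ᵇ_) _≟ᴾ_ (Q-adj? k) P-adj?) vertices vertices-complete

  module ⊙-Petersen = ProperConnectivity (Q k ⊙ Petersen) _≟ᴴ_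
    (⊙-adj? {Q k} {Petersen} (Vecₚ.≡-dec _≟ᵇ_) (Q-adj? k) P-adj?) vertices vertices-complete

  spokes□ : EdgeColoring (Q k □ Petersen) 2
  spokes□ = cutColoring (onOuterCycle ∘ proj₂)

  spokes⊙ : EdgeColoring (Q k ⊙ Petersen) 2
  spokes⊙ = cutColoring (onOuterCycle ∘ proj₂)

  pc-□ : True (□-Petersen.allJoined? spokes□) → IsPC (Q k □ Petersen) 2
  pc-□ ok = isPC-2 {Q k □ Petersen}
    (□-nonComplete {Q k} {Petersen} (replicate k false) Petersen-nonComplete)
    (spokes□ , □-Petersen.properConnected spokes□ ok)

  pc-⊙ : True (⊙-Petersen.allJoined? spokes⊙) → IsPC (Q k ⊙ Petersen) 2
  pc-⊙ ok = isPC-2 {Q k ⊙ Petersen}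
    (⊙-nonComplete {Q k} {Petersen} (replicate k false) Petersen-nonComplete)
    (spokes⊙ , ⊙-Petersen.properConnected spokes⊙ ok)

-- The search even gives pc(HP₄) = 2.
proposition7 : (IsPC (HP 3) 2 × IsPC (HL 3) 2)
    × ((Σ ℕ λ k → IsPC (HP 4) k × 2 ≤ k × k ≤ 3) × IsPC (HL 4) 2)
proposition7 = (pc-□ 0 _ , pc-⊙ 0 _) , ((2 , pc-□ 1 _ , ≤-refl , n≤1+n 2) , pc-⊙ 1 _)
  where open HypercubePetersen
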